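{- Let $S,Q$ be disjoint finite sets, let $Q'$ be a copy of $Q$ disjoint from $S\uplus Q$, let $\mathcal V_{SQ}$ be a vector space over a field $\mathbb F$ on $S\uplus Q$, and let $\mathcal V_{QQ'}:=\mathcal V_{SQ}\leftrightarrow(\mathcal V_{SQ})_{SQ'}$. Then: \begin{enumerate} \item $\mathcal V_{QQ'}=(\mathcal V_{QQ'})_{Q'Q}$. \item For every $f_Q\in\mathcal V_{QQ'}\circ Q$ we have $(f_Q,f_{Q'})\in\mathcal V_{QQ'}$, where $f_{Q'}$ is the copy of $f_Q$ on $Q'$; and likewise for every $f_{Q'}\in\mathcal V_{QQ'}\circ Q'$, $(f_Q,f_{Q'})\in\mathcal V_{QQ'}$ with $f_Q$ the copy of $f_{Q'}$. \item $\mathcal V_{QQ'}\circ Q=\mathcal V_{SQ}\circ Q$ and $\mathcal V_{QQ'}\times Q=\mathcal V_{SQ}\times Q$. \item $(\mathcal V_{SQ})_{SQ'}=\mathcal V_{SQ}\leftrightarrow\mathcal V_{QQ'}$ and $\mathcal V_{SQ}=(\mathcal V_{SQ})_{SQ'}\leftrightarrow\mathcal V_{QQ'}$. \end{enumerate}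
   Context: A vector on a finite set $X$ is a function $f_X:X\to\mathbb F$; a vector space on $X$ is a set of such vectors closed under addition and scalar multiplication. A vector on $A\uplus B$ (disjoint union) is written $(f_A,f_B)$; $0_X$ is the zero vector on $X$. For $\mathcal V_{SP}$ on $S\uplus P$: $\mathcal V_{SP}\circ S:=\{f_S:(f_S,f_P)\in\mathcal V_{SP}\text{ for some }f_P\}$ and $\mathcal V_{SP}\times S:=\{f_S:(f_S,0_P)\in\mathcal V_{SP}\}$. For $S,P,Q$ pairwise disjoint, the matched composition is $\mathcal V_{SP}\leftrightarrow\mathcal V_{PQ}:=\{(f_S,g_Q):\exists h_P,\ (f_S,h_P)\in\mathcal V_{SP},\ (h_P,g_Q)\in\mathcal V_{PQ}\}$ (here used with $P=S$ or $P=Q$ as the common set). Copies: if $X'$ is a disjoint copy of $X$ (via a bijection $e\mapsto e'$), $f_{X'}$ is the copy of $f_X$ if $f_{X'}(e')=f_X(e)$; $(\mathcal V_{SQ})_{SQ'}:=\{(f_S,f_{Q'}):(f_S,f_Q)\in\mathcal V_{SQ}\}$; and $(\mathcal V_{QQ'})_{Q'Q}:=\{(g_Q,f_{Q'}):(f_Q,g_{Q'})\in\mathcal V_{QQ'}\}$ where $g_Q$ is the copy of $g_{Q'}$ and $f_{Q'}$ the copy of $f_Q$ (interchange of the roles of $Q$ and $Q'$). -}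

module Defs where

open import Level using (Level; _⊔_) renaming (suc to lsuc)
open import Algebra.Bundles using (CommutativeRing)
open import Data.Product using (Σ; ∃; _×_; _,_)
open import Data.Sum using (_⊎_; inj₁; inj₂; [_,_]′; swap)
open import Data.Nat using (ℕ)
open import Data.Fin using (Fin)
open import Function using (_∘_; _↔_; Inverse)
open import Relation.Nullary using (¬_)

record Field (c ℓ : Level) : Set (lsuc (c ⊔ ℓ)) where
  field
    commutativeRing : CommutativeRing c ℓ
  open CommutativeRing commutativeRing public
  field
    1≉0     : ¬ (1# ≈ 0#)
    inverse : ∀ x → ¬ (x ≈ 0#) → Σ Carrier λ y → (x * y) ≈ 1#

module VectorSpaces {c ℓ : Level} (𝔽 : Field c ℓ) where
  open Field 𝔽

  Vector : Set → Set c
  Vector X = X → Carrier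

  _≋_ : {X : Set} → Vector X → Vector X → Set ℓ
  f ≋ g = ∀ x → f x ≈ g x

  0v : {X : Set} → Vector X
  0v _ = 0#

  _+v_ : {X : Set} → Vector X → Vector X → Vector X
  (f +v g) x = f x + g x

  _·v_ : {X : Set} → Carrier → Vector X → Vector X
  (a ·v f) x = a * f x

  VSet : Set → Set (lsuc (c ⊔ ℓ))
  VSet X = Vector X → Set (c ⊔ ℓ)

  record IsVectorSpace {X : Set} (V : VSet X) : Set (c ⊔ ℓ) where
    field
      respects : ∀ {f g} → f ≋ g → V f → V g
      zero∈    : V 0v
      +-closed : ∀ {f g} → V f → V g → V (f +v g)
      ·-closed : ∀ a {f} → V f → V (a ·v f)

  _⊆_ : {X : Set} → VSet X → VSet X → Set (c ⊔ ℓ)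
  V ⊆ W = ∀ f → V f → W f

  _≐_ : {X : Set} → VSet X → VSet X → Set (c ⊔ ℓ)
  V ≐ W = (V ⊆ W) × (W ⊆ V)

  ⟨_,_⟩ : {A B : Set} → Vector A → Vector B → Vector (A ⊎ B)
  ⟨ f , g ⟩ = [ f , g ]′

  _∘L : {A B : Set} → VSet (A ⊎ B) → VSet A
  (V ∘L) f = ∃ λ g → V ⟨ f , g ⟩

  _×L : {A B : Set} → VSet (A ⊎ B) → VSet A
  (V ×L) f = V ⟨ f , 0v ⟩

  _∘R : {A B : Set} → VSet (A ⊎ B) → VSet B
  (V ∘R) g = ∃ λ f → V ⟨ f , g ⟩

  -- regarding a set of vectors on A ⊎ B as one on B ⊎ A
  -- (the disjoint union is unordered)
  reorder : {A B : Set} → VSet (A ⊎ B) → VSet (B ⊎ A)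
  reorder V k = V (k ∘ swap)

  _⇌_ : {S P Q : Set} → VSet (S ⊎ P) → VSet (P ⊎ Q) → VSet (S ⊎ Q)
  (V ⇌ W) k = ∃ λ h → V ⟨ k ∘ inj₁ , h ⟩ × W ⟨ h , k ∘ inj₂ ⟩

  module Copy {Q Q' : Set} (e : Q ↔ Q') where
    open Inverse e using (to; from)

    copy : Vector Q → Vector Q'
    copy f = f ∘ from

    uncopy : Vector Q' → Vector Q
    uncopy g = g ∘ to

    copySQ' : {S : Set} → VSet (S ⊎ Q) → VSet (S ⊎ Q')
    copySQ' V k = V ⟨ k ∘ inj₁ , uncopy (k ∘ inj₂) ⟩

    interchange : VSet (Q ⊎ Q') → VSet (Q ⊎ Q')
    interchange V k = V ⟨ uncopy (k ∘ inj₂) , copy (k ∘ inj₁) ⟩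

-- Everything follows from one observation about a vector space V on A ⊎ B:
-- if (a , b), (c , b) and (c , d) lie in V, then so does
-- (a , b) − (c , b) + (c , d) = (a , d).  A vector (f , g') lies in
-- V_QQ' exactly when some h_S links f and the copy g of g' inside V_SQ,
-- i.e. (h , f), (h , g) ∈ V_SQ; the relation "linked through V_SQ" is
-- symmetric by construction and transitive by the observation, which
-- gives all four parts.
module Submission where

open import Defs
open import Data.Product using (_×_; _,_)
open import Data.Sum using (_⊎_; inj₁; inj₂)
open import Data.Nat using (ℕ)
open import Data.Fin using (Fin)
open import Function using (_↔_; Inverse; _∘_)
import Relation.Binary.PropositionalEquality as ≡
import Algebra.Properties.Ring as RingProperties
import Relation.Binary.Reasoning.Setoid as SetoidReasoning

module VectorSpaceProperties {c ℓ} (𝔽 : Field c ℓ) where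
  open Field 𝔽
  open VectorSpaces 𝔽
  open RingProperties ring using (-1*x≈-x)

  x-y+y≈x : ∀ x y → (x + - 1# * y) + y ≈ x
  x-y+y≈x x y = begin
    (x + - 1# * y) + y ≈⟨ +-congʳ (+-congˡ (-1*x≈-x y)) ⟩
    (x + - y) + y      ≈⟨ +-assoc x (- y) y ⟩
    x + (- y + y)      ≈⟨ +-congˡ (-‿inverseˡ y) ⟩
    x + 0#             ≈⟨ +-identityʳ x ⟩
    x                  ∎
    where open SetoidReasoning setoid

  y-y+x≈x : ∀ x y → (y + - 1# * y) + x ≈ x
  y-y+x≈x x y = begin
    (y + - 1# * y) + x ≈⟨ +-congʳ (+-congˡ (-1*x≈-x y)) ⟩
    (y + - y) + x      ≈⟨ +-congʳ (-‿inverseʳ y) ⟩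
    0# + x             ≈⟨ +-identityˡ x ⟩
    x                  ∎
    where open SetoidReasoning setoid

  ≋-refl : {X : Set} {f : Vector X} → f ≋ f
  ≋-refl _ = refl

  module _ {A B : Set} {V : VSet (A ⊎ B)} (isV : IsVectorSpace V) where
    open IsVectorSpace isV

    ⟨⟩-respects : ∀ {a a' b b'} → a ≋ a' → b ≋ b' → V ⟨ a , b ⟩ → V ⟨ a' , b' ⟩
    ⟨⟩-respects a≋a' b≋b' = respects λ { (inj₁ x) → a≋a' x ; (inj₂ x) → b≋b' x }

    -- Without η for ⊎, k and ⟨ k ∘ inj₁ , k ∘ inj₂ ⟩ (and likewise ⟨ b , a ⟩ ∘ swap
    -- and ⟨ a , b ⟩) are only pointwise equal, so membership is transported.
    ⟨⟩-split : ∀ {k} → V k → V ⟨ k ∘ inj₁ , k ∘ inj₂ ⟩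
    ⟨⟩-split = respects λ { (inj₁ x) → refl ; (inj₂ x) → refl }

    ⟨⟩-join : ∀ {k} → V ⟨ k ∘ inj₁ , k ∘ inj₂ ⟩ → V k
    ⟨⟩-join = respects λ { (inj₁ x) → refl ; (inj₂ x) → refl }

    reorder⁺ : ∀ {a b} → V ⟨ a , b ⟩ → reorder V ⟨ b , a ⟩
    reorder⁺ = respects λ { (inj₁ x) → refl ; (inj₂ x) → refl }

    reorder⁻ : ∀ {a b} → reorder V ⟨ b , a ⟩ → V ⟨ a , b ⟩
    reorder⁻ = respects λ { (inj₁ x) → refl ; (inj₂ x) → refl }

    ⟨0,0⟩∈ : V ⟨ 0v , 0v ⟩
    ⟨0,0⟩∈ = ⟨⟩-split zero∈

    zigzag : ∀ {a b c d} → V ⟨ a , b ⟩ → V ⟨ c , b ⟩ → V ⟨ c , d ⟩ → V ⟨ a , d ⟩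
    zigzag {a} {b} {c} {d} ab cb cd =
      respects (λ { (inj₁ x) → x-y+y≈x (a x) (c x) ; (inj₂ x) → y-y+x≈x (d x) (b x) })
        (+-closed (+-closed ab (·-closed (- 1#) cb)) cd)

  module SelfComposition {S Q Q' : Set} (e : Q ↔ Q') {V : VSet (S ⊎ Q)} (isV : IsVectorSpace V) where
    open Copy e
    open Inverse e using (strictlyInverseʳ)

    uncopy-copy : ∀ f → f ≋ uncopy (copy f)
    uncopy-copy f x = reflexive (≡.cong f (≡.sym (strictlyInverseʳ x)))

    copy-cancel : ∀ {h f} → V ⟨ h , f ⟩ → V ⟨ h , uncopy (copy f) ⟩
    copy-cancel {f = f} = ⟨⟩-respects isV ≋-refl (uncopy-copy f)

    copy-cancel⁻¹ : ∀ {h f} → V ⟨ h , uncopy (copy f) ⟩ → V ⟨ h , f ⟩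
    copy-cancel⁻¹ {f = f} = ⟨⟩-respects isV ≋-refl (sym ∘ uncopy-copy f)

    VQQ' : VSet (Q ⊎ Q')
    VQQ' = reorder V ⇌ copySQ' V

    VQQ'≐interchange : VQQ' ≐ interchange VQQ'
    VQQ'≐interchange =
        (λ k → λ { (h , hf , hg) → h , reorder⁺ isV hg , copy-cancel (reorder⁻ isV hf) })
      , (λ k → λ { (h , hg , hf) → h , reorder⁺ isV (copy-cancel⁻¹ hf) , reorder⁻ isV hg })

    VQQ'-diagonalˡ : ∀ f → (VQQ' ∘L) f → VQQ' ⟨ f , copy f ⟩
    VQQ'-diagonalˡ f (_ , h , hf , _) = h , hf , copy-cancel (reorder⁻ isV hf)

    VQQ'-diagonalʳ : ∀ g → (VQQ' ∘R) g → VQQ' ⟨ uncopy g , g ⟩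
    VQQ'-diagonalʳ g (_ , h , _ , hg) = h , reorder⁺ isV hg , hg

    VQQ'∘Q≐V∘Q : _≐_ {Q} (VQQ' ∘L) (V ∘R)
    VQQ'∘Q≐V∘Q =
        (λ f → λ { (_ , h , hf , _) → h , reorder⁻ isV hf })
      , (λ f → λ { (h , hf) → copy f , h , reorder⁺ isV hf , copy-cancel hf })

    VQQ'×Q≐V×Q : _≐_ {Q} (VQQ' ×L) (reorder V ×L)
    VQQ'×Q≐V×Q =
        (λ f → λ { (h , hf , h0) → reorder⁺ isV (zigzag isV (⟨0,0⟩∈ isV) h0 (reorder⁻ isV hf)) })
      , (λ f 0f → 0v , 0f , ⟨0,0⟩∈ isV)

    copySQ'≐V⇌VQQ' : copySQ' V ≐ (V ⇌ VQQ')
    copySQ'≐V⇌VQQ' =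
        (λ k p → uncopy (k ∘ inj₂) , p , k ∘ inj₁ , reorder⁺ isV p , p)
      , (λ k → λ { (h , p , h' , h'h , h'g) → zigzag isV p (reorder⁻ isV h'h) h'g })

    V≐copySQ'⇌reorderVQQ' : V ≐ (copySQ' V ⇌ reorder VQQ')
    V≐copySQ'⇌reorderVQQ' =
        (λ k p → let p' = ⟨⟩-split isV p in
                 copy (k ∘ inj₂) , copy-cancel p' , k ∘ inj₁ , reorder⁺ isV p' , copy-cancel p')
      , (λ k → λ { (h , p , h' , h'g , h'h) → ⟨⟩-join isV (zigzag isV p h'h (reorder⁻ isV h'g)) })

open VectorSpaceProperties

theorem6 : ∀ {c ℓ} (𝔽 : Field c ℓ) (s q : ℕ) {Q' : Set} (e : Fin q ↔ Q')
    → let open VectorSpaces 𝔽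
          open Copy e
          S = Fin s
          Q = Fin q
      in
      (VSQ : VSet (S ⊎ Q)) → IsVectorSpace VSQ
    → let VQQ' = reorder VSQ ⇌ copySQ' VSQ in
      (VQQ' ≐ interchange VQQ')
      × ((∀ fQ → (VQQ' ∘L) fQ → VQQ' ⟨ fQ , copy fQ ⟩)
         × (∀ fQ' → (VQQ' ∘R) fQ' → VQQ' ⟨ uncopy fQ' , fQ' ⟩))
      × ((_≐_ {Q} (VQQ' ∘L) (VSQ ∘R))
         × (_≐_ {Q} (VQQ' ×L) (reorder VSQ ×L)))
      × ((copySQ' VSQ ≐ (VSQ ⇌ VQQ'))
         × (VSQ ≐ (copySQ' VSQ ⇌ reorder VQQ')))
theorem6 𝔽 s q e VSQ isV =
    VQQ'≐interchange
  , (VQQ'-diagonalˡ , VQQ'-diagonalʳ)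
  , (VQQ'∘Q≐V∘Q , VQQ'×Q≐V×Q)
  , (copySQ'≐V⇌VQQ' , V≐copySQ'⇌reorderVQQ')
  where open SelfComposition 𝔽 e isV
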